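{- In the I-phase model $(D_{\mathcal E},\dagger)$, for every formula $A$: (1) for every term-constant $c^D$, every $n\ge0$ and $T_1,\dots,T_n$ each a term or an atom, if $c^DT_1\cdots T_n\in[\![A]\!]$ then $c^DT_1\cdots T_n\in A^\dagger$; (2) $A^\dagger\subseteq[\![A]\!]$.
   Context: $\mathbf{IL_{at}}$: formulas $A::=X\mid A\to B\mid\forall X.A$ ($X$ an atom); terms $t::=x\mid c^A\mid\lambda x.t\mid ts\mid\Lambda X.t\mid tX$ (a term-constant $c^A$ for every formula $A$; in $tX$, $X$ is an atom), up to $\alpha$-equivalence, capture-avoiding substitution; closed = no free term-variables; $FV(t)$ = free term- and propositional variables. Typing rules: $\Gamma,x:A\vdash x:A$; $\Gamma\vdash c^A:A$ for every $A$; $\Gamma,x:A\vdash t:B\Rightarrow\Gamma\vdash\lambda x.t:A\to B$; $\Gamma\vdash t:A\to B,\ \Gamma\vdash s:A\Rightarrow\Gamma\vdash ts:B$; $\Gamma\vdash t:A\Rightarrow\Gamma\vdash\Lambda X.t:\forall X.A$ provided $X$ not free in formulas of $\Gamma$; $\Gamma\vdash t:\forall X.A\Rightarrow\Gamma\vdash tY:A[X:=Y]$ ($Y$ an atom). $\beta$-reduction: compatible closure of $(\lambda x.t)s\to_\beta t[x:=s]$, $(\Lambda X.t)Y\to_\beta t[X:=Y]$; $\twoheadrightarrow$ its reflexive-transitive closure; normal = no redex. $\eta$-expansion: $t\to_{\eta^{ -1}}\lambda x.(tx)$ ($x\notin FV(t)$), $t\to_{\eta^{ -1}}\Lambda X.(tX)$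 ($X\notin FV(t)$). Domain: closed terms (pairs $(\emptyset\rhd t)$ over the one-element monoid). $[\![A]\!]=\{t\text{ closed}\mid t\twoheadrightarrow s,\ s\text{ normal},\ \vdash s:A\text{ derivable}\}$. I-phase model: $X^\dagger=[\![X]\!]$; $(B\to C)^\dagger=\{t\mid t\twoheadrightarrow u\to_{\eta^{ -1}}\lambda x.(ux)\text{ with }x\notin FV(u)\text{ and }us\in C^\dagger\text{ for all }s\in B^\dagger\}$; $(\forall X.A)^\dagger=\{t\mid t\twoheadrightarrow u\to_{\eta^{ -1}}\Lambda X.(uX)\text{ with }X\notin FV(u)\text{ and }uY\in(A[X:=Y])^\dagger\text{ for all atoms }Y\}$ (here $\twoheadrightarrow$ uses only $\beta$-steps and exactly one $\eta$-expansion is applied at the end). -}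

module Defs where

open import Data.Nat using (ℕ; zero; suc; _+_; _<_)
open import Data.List using (List; []; _∷_; map)
open import Data.Product using (Σ; Σ-syntax; _×_; _,_)
open import Data.Sum using (_⊎_; inj₁; inj₂)
open import Data.Unit using (⊤)
open import Data.Empty using (⊥)
open import Relation.Nullary using (¬_)
open import Relation.Binary.PropositionalEquality using (_≡_)
open import Relation.Binary.Construct.Closure.ReflexiveTransitive using (Star)

-- Formulas of IL_at (de Bruijn indices for propositional variables;
-- free indices are the atoms, α-equivalence is syntactic equality)

data Formula : Set where
  atom : ℕ → Formula
  _⇒_  : Formula → Formula → Formula
  all  : Formula → Formula

infixr 7 _⇒_

extR : (ℕ → ℕ) → ℕ → ℕ
extR ρ zero    = zero
extR ρ (suc n) = suc (ρ n)

renF : (ℕ → ℕ) → Formula → Formula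
renF ρ (atom X) = atom (ρ X)
renF ρ (A ⇒ B)  = renF ρ A ⇒ renF ρ B
renF ρ (all A)  = all (renF (extR ρ) A)

inst : ℕ → ℕ → ℕ
inst Y zero    = Y
inst Y (suc n) = n

instF : Formula → ℕ → Formula
instF A Y = renF (inst Y) A

shiftF : Formula → Formula
shiftF = renF suc

size : Formula → ℕ
size (atom X) = 1
size (A ⇒ B)  = suc (size A + size B)
size (all A)  = suc (size A)

data Term : Set where
  var  : ℕ → Term
  con  : Formula → Term
  lam  : Term → Term
  _·_  : Term → Term → Term
  Λ    : Term → Term
  _·ᵀ_ : Term → ℕ → Term

infixl 9 _·_ _·ᵀ_

renTT : (ℕ → ℕ) → Term → Term
renTT ρ (var x)  = var x
renTT ρ (con A)  = con (renF ρ A)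
renTT ρ (lam t)  = lam (renTT ρ t)
renTT ρ (t · s)  = renTT ρ t · renTT ρ s
renTT ρ (Λ t)    = Λ (renTT (extR ρ) t)
renTT ρ (t ·ᵀ Y) = renTT ρ t ·ᵀ ρ Y

ren : (ℕ → ℕ) → Term → Term
ren ρ (var x)  = var (ρ x)
ren ρ (con A)  = con A
ren ρ (lam t)  = lam (ren (extR ρ) t)
ren ρ (t · s)  = ren ρ t · ren ρ s
ren ρ (Λ t)    = Λ (ren ρ t)
ren ρ (t ·ᵀ Y) = ren ρ t ·ᵀ Y

exts : (ℕ → Term) → ℕ → Term
exts σ zero    = var zero
exts σ (suc n) = ren suc (σ n)

sub : (ℕ → Term) → Term → Term
sub σ (var x)  = σ x
sub σ (con A)  = con A
sub σ (lam t)  = lam (sub (exts σ) t)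
sub σ (t · s)  = sub σ t · sub σ s
sub σ (Λ t)    = Λ (sub (λ n → renTT suc (σ n)) t)
sub σ (t ·ᵀ Y) = sub σ t ·ᵀ Y

sub0 : Term → ℕ → Term
sub0 s zero    = s
sub0 s (suc n) = var n

_[_] : Term → Term → Term
t [ s ] = sub (sub0 s) t

_[_]ᵀ : Term → ℕ → Term
t [ Y ]ᵀ = renTT (inst Y) t

ClosedAt : ℕ → Term → Set
ClosedAt k (var x)  = x < k
ClosedAt k (con A)  = ⊤
ClosedAt k (lam t)  = ClosedAt (suc k) t
ClosedAt k (t · s)  = ClosedAt k t × ClosedAt k s
ClosedAt k (Λ t)    = ClosedAt k t
ClosedAt k (t ·ᵀ Y) = ClosedAt k t

Closed : Term → Set
Closed = ClosedAt zero

Ctx : Set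
Ctx = List Formula

data _∋_∶_ : Ctx → ℕ → Formula → Set where
  here  : ∀ {Γ A} → (A ∷ Γ) ∋ zero ∶ A
  there : ∀ {Γ A B x} → Γ ∋ x ∶ A → (B ∷ Γ) ∋ suc x ∶ A

infix 4 _∋_∶_ _⊢_∶_

data _⊢_∶_ : Ctx → Term → Formula → Set where
  ⊢var  : ∀ {Γ x A} → Γ ∋ x ∶ A → Γ ⊢ var x ∶ A
  ⊢con  : ∀ {Γ A} → Γ ⊢ con A ∶ A
  ⊢lam  : ∀ {Γ t A B} → (A ∷ Γ) ⊢ t ∶ B → Γ ⊢ lam t ∶ A ⇒ B
  ⊢app  : ∀ {Γ t s A B} → Γ ⊢ t ∶ A ⇒ B → Γ ⊢ s ∶ A → Γ ⊢ t · s ∶ B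
  -- side condition "X not free in Γ" is built in: Γ is shifted past X
  ⊢Λ    : ∀ {Γ t A} → map shiftF Γ ⊢ t ∶ A → Γ ⊢ Λ t ∶ all A
  ⊢tapp : ∀ {Γ t A} (Y : ℕ) → Γ ⊢ t ∶ all A → Γ ⊢ t ·ᵀ Y ∶ instF A Y

infix 4 _⟶β_ _↠_ _⟶η⁻¹_

data _⟶β_ : Term → Term → Set where
  β     : ∀ {t s} → lam t · s ⟶β t [ s ]
  βᵀ    : ∀ {t Y} → Λ t ·ᵀ Y ⟶β t [ Y ]ᵀ
  ξlam  : ∀ {t t'} → t ⟶β t' → lam t ⟶β lam t'
  ξappˡ : ∀ {t t' s} → t ⟶β t' → t · s ⟶β t' · s
  ξappʳ : ∀ {t s s'} → s ⟶β s' → t · s ⟶β t · s'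
  ξΛ    : ∀ {t t'} → t ⟶β t' → Λ t ⟶β Λ t'
  ξtapp : ∀ {t t' Y} → t ⟶β t' → t ·ᵀ Y ⟶β t' ·ᵀ Y

_↠_ : Term → Term → Set
_↠_ = Star _⟶β_

Normal : Term → Set
Normal t = ∀ s → ¬ (t ⟶β s)

data _⟶η⁻¹_ : Term → Term → Set where
  η⇒ : ∀ {u} → u ⟶η⁻¹ lam (ren suc u · var zero)
  η∀ : ∀ {u} → u ⟶η⁻¹ Λ (renTT suc u ·ᵀ zero)

⟦_⟧ : Formula → Term → Set
⟦ A ⟧ t = Closed t × Σ[ s ∈ Term ] (t ↠ s × Normal s × [] ⊢ s ∶ A)

-- A† defined by recursion with fuel (fuel = size A suffices, since
-- size (A[X:=Y]) = size A); the clauses are literally those of the paper.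
dagN : ℕ → Formula → Term → Set
dagN zero    A        t = ⊥
dagN (suc n) (atom X) t = ⟦ atom X ⟧ t
dagN (suc n) (B ⇒ C)  t =
  Closed t × Σ[ u ∈ Term ] (t ↠ u × u ⟶η⁻¹ lam (ren suc u · var zero)
     × (∀ s → dagN n B s → dagN n C (u · s)))
dagN (suc n) (all A)  t =
  Closed t × Σ[ u ∈ Term ] (t ↠ u × u ⟶η⁻¹ Λ (renTT suc u ·ᵀ zero)
     × (∀ (Y : ℕ) → dagN n (instF A Y) (u ·ᵀ Y)))

_† : Formula → Term → Set
A † = dagN (size A) A

spine : Term → List (Term ⊎ ℕ) → Term
spine h []            = h
spine h (inj₁ s ∷ Ts) = spine (h · s) Ts
spine h (inj₂ Y ∷ Ts) = spine (h ·ᵀ Y) Ts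

{-# OPTIONS --safe #-}
-- Both parts are proved together by induction on A (with fuel, since A[X:=Y]
-- has the size of A).
--
-- (1) A constant-headed spine c T₁…Tₙ ∈ [[B ⇒ C]] is its own η-witness: for
-- s ∈ B† ⊆ [[B]], the term c T₁…Tₙ s lies in [[C]] because a normal
-- constant-headed spine applied to a normal term is again normal, and then in
-- C† by (1) for C.
--
-- (2) By (1) the constant c^B lies in B†, so for t ∈ (B ⇒ C)† with t ↠ u the
-- term u c^B lies in C† ⊆ [[C]] and has a normal form.  Substituting a
-- constant creates no redex, so the reduction to that normal form either never
-- contracts the head, or passes through (λx.M) c^B with M ↠ M' and
-- M'[x:=c^B] normal; either way u itself has a normal form of type B ⇒ C.
-- For ∀X.A one instantiates X by an atom k fresh for u and A: renaming k back
-- to the bound variable undoes the instantiation, and the type of a normal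
-- neutral closed term mentions only atoms of the term, hence not k.
module Submission where

open import Defs
open import Data.Empty using (⊥; ⊥-elim)
open import Data.List using (List; []; _∷_; map)
open import Data.List.Properties using (map-∘; map-cong)
open import Data.Nat using (ℕ; zero; suc; _+_; _⊔_; _<_; _≤_; z≤n; s≤s)
open import Data.Nat.Properties using (≤-refl; ≤-trans; <-≤-trans; <-irrefl; m≤m+n; m≤n+m; m≤m⊔n; m≤n⊔m; n≤1+n; _≟_)
open import Data.Product using (Σ-syntax; _×_; _,_; proj₂)
open import Data.Sum using (_⊎_; inj₁; inj₂)
open import Data.Unit using (⊤; tt)
open import Function using (_∘_)
open import Relation.Nullary using (¬_; yes; no)
open import Relation.Binary.PropositionalEquality using (_≡_; _≗_; refl; sym; trans; cong; cong₂; subst; subst₂; module ≡-Reasoning)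
open import Relation.Binary.Construct.Closure.ReflexiveTransitive using (ε; _◅_; _◅◅_; gmap)

extR-∘ : ∀ {f g h} → (∀ x → f (g x) ≡ h x) → ∀ x → extR f (extR g x) ≡ extR h x
extR-∘ p zero    = refl
extR-∘ p (suc x) = cong suc (p x)

renF-∘ : ∀ {f g h} → (∀ x → f (g x) ≡ h x) → ∀ A → renF f (renF g A) ≡ renF h A
renF-∘ p (atom X) = cong atom (p X)
renF-∘ p (A ⇒ B)  = cong₂ _⇒_ (renF-∘ p A) (renF-∘ p B)
renF-∘ p (all A)  = cong all (renF-∘ (extR-∘ p) A)

size-renF : ∀ ρ A → size (renF ρ A) ≡ size A
size-renF ρ (atom X) = refl
size-renF ρ (A ⇒ B)  = cong₂ (λ a b → suc (a + b)) (size-renF ρ A) (size-renF ρ B)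
size-renF ρ (all A)  = cong suc (size-renF (extR ρ) A)

shiftF-renF : ∀ ρ A → renF (extR ρ) (shiftF A) ≡ shiftF (renF ρ A)
shiftF-renF ρ A = trans (renF-∘ (λ _ → refl) A) (sym (renF-∘ (λ _ → refl) A))

inst-extR : ∀ ρ Y x → inst (ρ Y) (extR ρ x) ≡ ρ (inst Y x)
inst-extR ρ Y zero    = refl
inst-extR ρ Y (suc x) = refl

instF-renF : ∀ ρ A Y → instF (renF (extR ρ) A) (ρ Y) ≡ renF ρ (instF A Y)
instF-renF ρ A Y = trans (renF-∘ (inst-extR ρ Y) A) (sym (renF-∘ (λ _ → refl) A))

BelowF : ℕ → Formula → Set
BelowF k (atom X) = X < k
BelowF k (A ⇒ B)  = BelowF k A × BelowF k B
BelowF k (all A)  = BelowF (suc k) A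

BelowT : ℕ → Term → Set
BelowT k (var x)  = ⊤
BelowT k (con A)  = BelowF k A
BelowT k (lam t)  = BelowT k t
BelowT k (t · s)  = BelowT k t × BelowT k s
BelowT k (Λ t)    = BelowT (suc k) t
BelowT k (t ·ᵀ Y) = BelowT k t × Y < k

BelowF-mono : ∀ {j k} → j ≤ k → ∀ A → BelowF j A → BelowF k A
BelowF-mono j≤k (atom X) X<j         = <-≤-trans X<j j≤k
BelowF-mono j≤k (A ⇒ B)  (A<j , B<j) = BelowF-mono j≤k A A<j , BelowF-mono j≤k B B<j
BelowF-mono j≤k (all A)  A<j         = BelowF-mono (s≤s j≤k) A A<j

BelowT-mono : ∀ {j k} → j ≤ k → ∀ t → BelowT j t → BelowT k t
BelowT-mono j≤k (var x)  _           = tt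
BelowT-mono j≤k (con A)  A<j         = BelowF-mono j≤k A A<j
BelowT-mono j≤k (lam t)  t<j         = BelowT-mono j≤k t t<j
BelowT-mono j≤k (t · s)  (t<j , s<j) = BelowT-mono j≤k t t<j , BelowT-mono j≤k s s<j
BelowT-mono j≤k (Λ t)    t<j         = BelowT-mono (s≤s j≤k) t t<j
BelowT-mono j≤k (t ·ᵀ Y) (t<j , Y<j) = BelowT-mono j≤k t t<j , <-≤-trans Y<j j≤k

BelowF-bound : ∀ A → Σ[ k ∈ ℕ ] BelowF k A
BelowF-bound (atom X) = suc X , ≤-refl
BelowF-bound (A ⇒ B) with BelowF-bound A | BelowF-bound B
... | j , A<j | k , B<k = j ⊔ k , BelowF-mono (m≤m⊔n j k) A A<j , BelowF-mono (m≤n⊔m j k) B B<k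
BelowF-bound (all A) with BelowF-bound A
... | k , A<k = k , BelowF-mono (n≤1+n k) A A<k

BelowT-bound : ∀ t → Σ[ k ∈ ℕ ] BelowT k t
BelowT-bound (var x) = 0 , tt
BelowT-bound (con A) = BelowF-bound A
BelowT-bound (lam t) = BelowT-bound t
BelowT-bound (t · s) with BelowT-bound t | BelowT-bound s
... | j , t<j | k , s<k = j ⊔ k , BelowT-mono (m≤m⊔n j k) t t<j , BelowT-mono (m≤n⊔m j k) s s<k
BelowT-bound (Λ t) with BelowT-bound t
... | k , t<k = k , BelowT-mono (n≤1+n k) t t<k
BelowT-bound (t ·ᵀ Y) with BelowT-bound t
... | k , t<k = k ⊔ suc Y , BelowT-mono (m≤m⊔n k (suc Y)) t t<k , m≤n⊔m k (suc Y)

-- BelowT k (u · con (all A)) unfolds to BelowT k u × BelowF (suc k) A.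
fresh-atom : ∀ u A → Σ[ k ∈ ℕ ] (BelowT k u × BelowF (suc k) A)
fresh-atom u A = BelowT-bound (u · con (all A))

MapsBelow : ℕ → ℕ → (ℕ → ℕ) → Set
MapsBelow j k ρ = ∀ {x} → x < j → ρ x < k

extR-below : ∀ {j k ρ} → MapsBelow j k ρ → MapsBelow (suc j) (suc k) (extR ρ)
extR-below ρ<k {zero}  _         = s≤s z≤n
extR-below ρ<k {suc x} (s≤s x<j) = s≤s (ρ<k x<j)

inst-below : ∀ {Y k} → Y < k → MapsBelow (suc k) k (inst Y)
inst-below Y<k {zero}  _         = Y<k
inst-below Y<k {suc x} (s≤s x<k) = x<k

BelowF-renF : ∀ {j k ρ} → MapsBelow j k ρ → ∀ A → BelowF j A → BelowF k (renF ρ A)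
BelowF-renF ρ<k (atom X) X<j         = ρ<k X<j
BelowF-renF ρ<k (A ⇒ B)  (A<j , B<j) = BelowF-renF ρ<k A A<j , BelowF-renF ρ<k B B<j
BelowF-renF ρ<k (all A)  A<j         = BelowF-renF (extR-below ρ<k) A A<j

BelowT-renTT : ∀ {j k ρ} → MapsBelow j k ρ → ∀ t → BelowT j t → BelowT k (renTT ρ t)
BelowT-renTT ρ<k (var x)  _           = tt
BelowT-renTT ρ<k (con A)  A<j         = BelowF-renF ρ<k A A<j
BelowT-renTT ρ<k (lam t)  t<j         = BelowT-renTT ρ<k t t<j
BelowT-renTT ρ<k (t · s)  (t<j , s<j) = BelowT-renTT ρ<k t t<j , BelowT-renTT ρ<k s s<j
BelowT-renTT ρ<k (Λ t)    t<j         = BelowT-renTT (extR-below ρ<k) t t<j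
BelowT-renTT ρ<k (t ·ᵀ Y) (t<j , Y<j) = BelowT-renTT ρ<k t t<j , ρ<k Y<j

BelowT-ren : ∀ {k} ρ t → BelowT k t → BelowT k (ren ρ t)
BelowT-ren ρ (var x)  _           = tt
BelowT-ren ρ (con A)  A<k         = A<k
BelowT-ren ρ (lam t)  t<k         = BelowT-ren (extR ρ) t t<k
BelowT-ren ρ (t · s)  (t<k , s<k) = BelowT-ren ρ t t<k , BelowT-ren ρ s s<k
BelowT-ren ρ (Λ t)    t<k         = BelowT-ren ρ t t<k
BelowT-ren ρ (t ·ᵀ Y) (t<k , Y<k) = BelowT-ren ρ t t<k , Y<k

BelowT-sub : ∀ {k} σ → (∀ x → BelowT k (σ x)) → ∀ t → BelowT k t → BelowT k (sub σ t)
BelowT-sub σ σ<k (var x)  _           = σ<k x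
BelowT-sub σ σ<k (con A)  A<k         = A<k
BelowT-sub σ σ<k (lam t)  t<k         = BelowT-sub (exts σ) exts<k t t<k
  where
    exts<k : ∀ x → BelowT _ (exts σ x)
    exts<k zero    = tt
    exts<k (suc x) = BelowT-ren suc (σ x) (σ<k x)
BelowT-sub σ σ<k (t · s)  (t<k , s<k) = BelowT-sub σ σ<k t t<k , BelowT-sub σ σ<k s s<k
BelowT-sub σ σ<k (Λ t)    t<k         =
  BelowT-sub _ (λ x → BelowT-renTT s≤s (σ x) (σ<k x)) t t<k
BelowT-sub σ σ<k (t ·ᵀ Y) (t<k , Y<k) = BelowT-sub σ σ<k t t<k , Y<k

BelowT-⟶β : ∀ {k t t'} → t ⟶β t' → BelowT k t → BelowT k t'
BelowT-⟶β {k} (β {t} {s}) (t<k , s<k) = BelowT-sub (sub0 s) sub0<k t t<k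
  where
    sub0<k : ∀ x → BelowT k (sub0 s x)
    sub0<k zero    = s<k
    sub0<k (suc x) = tt
BelowT-⟶β (βᵀ {t})   (t<k , Y<k) = BelowT-renTT (inst-below Y<k) t t<k
BelowT-⟶β (ξlam st)  t<k         = BelowT-⟶β st t<k
BelowT-⟶β (ξappˡ st) (t<k , s<k) = BelowT-⟶β st t<k , s<k
BelowT-⟶β (ξappʳ st) (t<k , s<k) = t<k , BelowT-⟶β st s<k
BelowT-⟶β (ξΛ st)    t<k         = BelowT-⟶β st t<k
BelowT-⟶β (ξtapp st) (t<k , Y<k) = BelowT-⟶β st t<k , Y<k

BelowT-↠ : ∀ {k t t'} → t ↠ t' → BelowT k t → BelowT k t'
BelowT-↠ ε        t<k = t<k
BelowT-↠ (st ◅ r) t<k = BelowT-↠ r (BelowT-⟶β st t<k)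

extR-id-below : ∀ {k h} → (∀ {x} → x < k → h x ≡ x) → ∀ {x} → x < suc k → extR h x ≡ x
extR-id-below h≡id {zero}  _         = refl
extR-id-below h≡id {suc x} (s≤s x<k) = cong suc (h≡id x<k)

renF-id-below : ∀ {k h} → (∀ {x} → x < k → h x ≡ x) → ∀ A → BelowF k A → renF h A ≡ A
renF-id-below h≡id (atom X) X<k         = cong atom (h≡id X<k)
renF-id-below h≡id (A ⇒ B)  (A<k , B<k) = cong₂ _⇒_ (renF-id-below h≡id A A<k) (renF-id-below h≡id B B<k)
renF-id-below h≡id (all A)  A<k         = cong all (renF-id-below (extR-id-below h≡id) A A<k)

renTT-id-below : ∀ {k h} → (∀ {x} → x < k → h x ≡ x) → ∀ t → BelowT k t → renTT h t ≡ t
renTT-id-below h≡id (var x)  _           = refl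
renTT-id-below h≡id (con A)  A<k         = cong con (renF-id-below h≡id A A<k)
renTT-id-below h≡id (lam t)  t<k         = cong lam (renTT-id-below h≡id t t<k)
renTT-id-below h≡id (t · s)  (t<k , s<k) = cong₂ _·_ (renTT-id-below h≡id t t<k) (renTT-id-below h≡id s s<k)
renTT-id-below h≡id (Λ t)    t<k         = cong Λ (renTT-id-below (extR-id-below h≡id) t t<k)
renTT-id-below h≡id (t ·ᵀ Y) (t<k , Y<k) = cong₂ _·ᵀ_ (renTT-id-below h≡id t t<k) (h≡id Y<k)

renTT-∘ : ∀ {f g h} → (∀ x → f (g x) ≡ h x) → ∀ t → renTT f (renTT g t) ≡ renTT h t
renTT-∘ p (var x)  = refl
renTT-∘ p (con A)  = cong con (renF-∘ p A)
renTT-∘ p (lam t)  = cong lam (renTT-∘ p t)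
renTT-∘ p (t · s)  = cong₂ _·_ (renTT-∘ p t) (renTT-∘ p s)
renTT-∘ p (Λ t)    = cong Λ (renTT-∘ (extR-∘ p) t)
renTT-∘ p (t ·ᵀ Y) = cong₂ _·ᵀ_ (renTT-∘ p t) (p Y)

renTT-cancel : ∀ {f g} → (∀ x → f (g x) ≡ x) → ∀ t → renTT f (renTT g t) ≡ t
renTT-cancel p t = trans (renTT-∘ p t) (renTT-id-below (λ _ → refl) t (proj₂ (BelowT-bound t)))

renTT-shift : ∀ ρ t → renTT (extR ρ) (renTT suc t) ≡ renTT suc (renTT ρ t)
renTT-shift ρ t = trans (renTT-∘ (λ _ → refl) t) (sym (renTT-∘ (λ _ → refl) t))

ren-∘ : ∀ {f g h} → (∀ x → f (g x) ≡ h x) → ∀ t → ren f (ren g t) ≡ ren h t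
ren-∘ p (var x)  = cong var (p x)
ren-∘ p (con A)  = refl
ren-∘ p (lam t)  = cong lam (ren-∘ (extR-∘ p) t)
ren-∘ p (t · s)  = cong₂ _·_ (ren-∘ p t) (ren-∘ p s)
ren-∘ p (Λ t)    = cong Λ (ren-∘ p t)
ren-∘ p (t ·ᵀ Y) = cong (_·ᵀ Y) (ren-∘ p t)

ren-shift : ∀ ρ t → ren (extR ρ) (ren suc t) ≡ ren suc (ren ρ t)
ren-shift ρ t = trans (ren-∘ (λ _ → refl) t) (sym (ren-∘ (λ _ → refl) t))

renTT-ren : ∀ f ρ t → renTT f (ren ρ t) ≡ ren ρ (renTT f t)
renTT-ren f ρ (var x)  = refl
renTT-ren f ρ (con A)  = refl
renTT-ren f ρ (lam t)  = cong lam (renTT-ren f (extR ρ) t)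
renTT-ren f ρ (t · s)  = cong₂ _·_ (renTT-ren f ρ t) (renTT-ren f ρ s)
renTT-ren f ρ (Λ t)    = cong Λ (renTT-ren (extR f) ρ t)
renTT-ren f ρ (t ·ᵀ Y) = cong (_·ᵀ f Y) (renTT-ren f ρ t)

extsᵀ : (ℕ → Term) → ℕ → Term
extsᵀ σ x = renTT suc (σ x)

exts-cong : ∀ {σ τ} → σ ≗ τ → exts σ ≗ exts τ
exts-cong σ≗τ zero    = refl
exts-cong σ≗τ (suc x) = cong (ren suc) (σ≗τ x)

sub-cong : ∀ {σ τ} → σ ≗ τ → sub σ ≗ sub τ
sub-cong σ≗τ (var x)  = σ≗τ x
sub-cong σ≗τ (con A)  = refl
sub-cong σ≗τ (lam t)  = cong lam (sub-cong (exts-cong σ≗τ) t)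
sub-cong σ≗τ (t · s)  = cong₂ _·_ (sub-cong σ≗τ t) (sub-cong σ≗τ s)
sub-cong σ≗τ (Λ t)    = cong Λ (sub-cong (cong (renTT suc) ∘ σ≗τ) t)
sub-cong σ≗τ (t ·ᵀ Y) = cong (_·ᵀ Y) (sub-cong σ≗τ t)

sub-id : ∀ {σ} → σ ≗ var → ∀ t → sub σ t ≡ t
sub-id σ≗var (var x)  = σ≗var x
sub-id σ≗var (con A)  = refl
sub-id σ≗var (lam t)  = cong lam (sub-id exts≗var t)
  where
    exts≗var : exts _ ≗ var
    exts≗var zero    = refl
    exts≗var (suc x) = cong (ren suc) (σ≗var x)
sub-id σ≗var (t · s)  = cong₂ _·_ (sub-id σ≗var t) (sub-id σ≗var s)
sub-id σ≗var (Λ t)    = cong Λ (sub-id (cong (renTT suc) ∘ σ≗var) t)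
sub-id σ≗var (t ·ᵀ Y) = cong (_·ᵀ Y) (sub-id σ≗var t)

renTT-sub : ∀ f σ t → renTT f (sub σ t) ≡ sub (renTT f ∘ σ) (renTT f t)
renTT-sub f σ (var x)  = refl
renTT-sub f σ (con A)  = refl
renTT-sub f σ (lam t)  =
  cong lam (trans (renTT-sub f (exts σ) t) (sub-cong renTT-exts (renTT f t)))
  where
    renTT-exts : renTT f ∘ exts σ ≗ exts (renTT f ∘ σ)
    renTT-exts zero    = refl
    renTT-exts (suc x) = renTT-ren f suc (σ x)
renTT-sub f σ (t · s)  = cong₂ _·_ (renTT-sub f σ t) (renTT-sub f σ s)
renTT-sub f σ (Λ t)    =
  cong Λ (trans (renTT-sub (extR f) (extsᵀ σ) t) (sub-cong (renTT-shift f ∘ σ) (renTT (extR f) t)))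
renTT-sub f σ (t ·ᵀ Y) = cong (_·ᵀ f Y) (renTT-sub f σ t)

ren-sub : ∀ ρ σ t → ren ρ (sub σ t) ≡ sub (ren ρ ∘ σ) t
ren-sub ρ σ (var x)  = refl
ren-sub ρ σ (con A)  = refl
ren-sub ρ σ (lam t)  = cong lam (trans (ren-sub (extR ρ) (exts σ) t) (sub-cong ren-exts t))
  where
    ren-exts : ren (extR ρ) ∘ exts σ ≗ exts (ren ρ ∘ σ)
    ren-exts zero    = refl
    ren-exts (suc x) = ren-shift ρ (σ x)
ren-sub ρ σ (t · s)  = cong₂ _·_ (ren-sub ρ σ t) (ren-sub ρ σ s)
ren-sub ρ σ (Λ t)    =
  cong Λ (trans (ren-sub ρ (extsᵀ σ) t) (sub-cong (λ x → sym (renTT-ren suc ρ (σ x))) t))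
ren-sub ρ σ (t ·ᵀ Y) = cong (_·ᵀ Y) (ren-sub ρ σ t)

sub-ren : ∀ σ ρ t → sub σ (ren ρ t) ≡ sub (σ ∘ ρ) t
sub-ren σ ρ (var x)  = refl
sub-ren σ ρ (con A)  = refl
sub-ren σ ρ (lam t)  = cong lam (trans (sub-ren (exts σ) (extR ρ) t) (sub-cong exts-extR t))
  where
    exts-extR : exts σ ∘ extR ρ ≗ exts (σ ∘ ρ)
    exts-extR zero    = refl
    exts-extR (suc x) = refl
sub-ren σ ρ (t · s)  = cong₂ _·_ (sub-ren σ ρ t) (sub-ren σ ρ s)
sub-ren σ ρ (Λ t)    = cong Λ (sub-ren (extsᵀ σ) ρ t)
sub-ren σ ρ (t ·ᵀ Y) = cong (_·ᵀ Y) (sub-ren σ ρ t)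

sub-sub : ∀ τ σ t → sub τ (sub σ t) ≡ sub (sub τ ∘ σ) t
sub-sub τ σ (var x)  = refl
sub-sub τ σ (con A)  = refl
sub-sub τ σ (lam t)  = cong lam (trans (sub-sub (exts τ) (exts σ) t) (sub-cong sub-exts t))
  where
    sub-exts : sub (exts τ) ∘ exts σ ≗ exts (sub τ ∘ σ)
    sub-exts zero    = refl
    sub-exts (suc x) = trans (sub-ren (exts τ) suc (σ x)) (sym (ren-sub suc τ (σ x)))
sub-sub τ σ (t · s)  = cong₂ _·_ (sub-sub τ σ t) (sub-sub τ σ s)
sub-sub τ σ (Λ t)    =
  cong Λ (trans (sub-sub (extsᵀ τ) (extsᵀ σ) t) (sub-cong (λ x → sym (renTT-sub suc τ (σ x))) t))
sub-sub τ σ (t ·ᵀ Y) = cong (_·ᵀ Y) (sub-sub τ σ t)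

sub-[] : ∀ σ P Q → sub (exts σ) P [ sub σ Q ] ≡ sub σ (P [ Q ])
sub-[] σ P Q = begin
  sub (sub0 (sub σ Q)) (sub (exts σ) P)   ≡⟨ sub-sub _ (exts σ) P ⟩
  sub (sub (sub0 (sub σ Q)) ∘ exts σ) P   ≡⟨ sub-cong sub0-exts P ⟩
  sub (sub σ ∘ sub0 Q) P                  ≡⟨ sub-sub σ (sub0 Q) P ⟨
  sub σ (sub (sub0 Q) P)                  ∎
  where
    open ≡-Reasoning
    sub0-exts : sub (sub0 (sub σ Q)) ∘ exts σ ≗ sub σ ∘ sub0 Q
    sub0-exts zero    = refl
    sub0-exts (suc x) = trans (sub-ren _ suc (σ x)) (sub-id (λ _ → refl) (σ x))

sub-[]ᵀ : ∀ σ P Y → sub (extsᵀ σ) P [ Y ]ᵀ ≡ sub σ (P [ Y ]ᵀ)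
sub-[]ᵀ σ P Y =
  trans (renTT-sub (inst Y) (extsᵀ σ) P) (sub-cong (renTT-cancel (λ _ → refl) ∘ σ) (P [ Y ]ᵀ))

renTT-[] : ∀ ρ P Q → renTT ρ P [ renTT ρ Q ] ≡ renTT ρ (P [ Q ])
renTT-[] ρ P Q = sym (trans (renTT-sub ρ (sub0 Q) P) (sub-cong renTT-sub0 (renTT ρ P)))
  where
    renTT-sub0 : renTT ρ ∘ sub0 Q ≗ sub0 (renTT ρ Q)
    renTT-sub0 zero    = refl
    renTT-sub0 (suc x) = refl

renTT-[]ᵀ : ∀ ρ P Y → renTT (extR ρ) P [ ρ Y ]ᵀ ≡ renTT ρ (P [ Y ]ᵀ)
renTT-[]ᵀ ρ P Y = trans (renTT-∘ (inst-extR ρ Y) P) (sym (renTT-∘ (λ _ → refl) P))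

sub-⟶β : ∀ σ {M M'} → M ⟶β M' → sub σ M ⟶β sub σ M'
sub-⟶β σ (β {P} {Q})  = subst (sub σ (lam P · Q) ⟶β_) (sub-[] σ P Q) β
sub-⟶β σ (βᵀ {P} {Y}) = subst (sub σ (Λ P ·ᵀ Y) ⟶β_) (sub-[]ᵀ σ P Y) βᵀ
sub-⟶β σ (ξlam st)    = ξlam (sub-⟶β (exts σ) st)
sub-⟶β σ (ξappˡ st)   = ξappˡ (sub-⟶β σ st)
sub-⟶β σ (ξappʳ st)   = ξappʳ (sub-⟶β σ st)
sub-⟶β σ (ξΛ st)      = ξΛ (sub-⟶β (extsᵀ σ) st)
sub-⟶β σ (ξtapp st)   = ξtapp (sub-⟶β σ st)

renTT-⟶β : ∀ ρ {M M'} → M ⟶β M' → renTT ρ M ⟶β renTT ρ M'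
renTT-⟶β ρ (β {P} {Q})  = subst (renTT ρ (lam P · Q) ⟶β_) (renTT-[] ρ P Q) β
renTT-⟶β ρ (βᵀ {P} {Y}) = subst (renTT ρ (Λ P ·ᵀ Y) ⟶β_) (renTT-[]ᵀ ρ P Y) βᵀ
renTT-⟶β ρ (ξlam st)    = ξlam (renTT-⟶β ρ st)
renTT-⟶β ρ (ξappˡ st)   = ξappˡ (renTT-⟶β ρ st)
renTT-⟶β ρ (ξappʳ st)   = ξappʳ (renTT-⟶β ρ st)
renTT-⟶β ρ (ξΛ st)      = ξΛ (renTT-⟶β (extR ρ) st)
renTT-⟶β ρ (ξtapp st)   = ξtapp (renTT-⟶β ρ st)

Normal-sub⁻ : ∀ σ {M} → Normal (sub σ M) → Normal M
Normal-sub⁻ σ nf _ st = nf _ (sub-⟶β σ st)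

Normal-renTT⁻ : ∀ ρ {M} → Normal (renTT ρ M) → Normal M
Normal-renTT⁻ ρ nf _ st = nf _ (renTT-⟶β ρ st)

Normal-con : ∀ {A} → Normal (con A)
Normal-con _ ()

Normal-lam : ∀ {M} → Normal M → Normal (lam M)
Normal-lam nf _ (ξlam st) = nf _ st

Normal-Λ : ∀ {M} → Normal M → Normal (Λ M)
Normal-Λ nf _ (ξΛ st) = nf _ st

Normal-app-head : ∀ {t s} → Normal (t · s) → Normal t
Normal-app-head nf _ st = nf _ (ξappˡ st)

Normal-tapp-head : ∀ {t Y} → Normal (t ·ᵀ Y) → Normal t
Normal-tapp-head nf _ st = nf _ (ξtapp st)

data Inert : Term → Set where
  var : ∀ {x} → Inert (var x)
  con : ∀ {A} → Inert (con A)

InertSub : (ℕ → Term) → Set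
InertSub σ = ∀ x → Inert (σ x)

Inert-ren : ∀ ρ {t} → Inert t → Inert (ren ρ t)
Inert-ren ρ var = var
Inert-ren ρ con = con

Inert-renTT : ∀ ρ {t} → Inert t → Inert (renTT ρ t)
Inert-renTT ρ var = var
Inert-renTT ρ con = con

exts-inert : ∀ {σ} → InertSub σ → InertSub (exts σ)
exts-inert inert zero    = var
exts-inert inert (suc x) = Inert-ren suc (inert x)

extsᵀ-inert : ∀ {σ} → InertSub σ → InertSub (extsᵀ σ)
extsᵀ-inert inert x = Inert-renTT suc (inert x)

sub0-inert : ∀ {s} → Inert s → InertSub (sub0 s)
sub0-inert inert zero    = inert
sub0-inert inert (suc x) = var

Inert-normal : ∀ {t} → Inert t → Normal t
Inert-normal var _ ()
Inert-normal con _ ()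

Inert-tapp-normal : ∀ {t Y} → Inert t → Normal (t ·ᵀ Y)
Inert-tapp-normal inert _ (ξtapp st) = Inert-normal inert _ st

Inert-app-⟶β : ∀ {h s N} → Inert h → h · s ⟶β N → Σ[ s' ∈ Term ] (s ⟶β s' × N ≡ h · s')
Inert-app-⟶β var (ξappʳ st) = _ , st , refl
Inert-app-⟶β con (ξappʳ st) = _ , st , refl

-- Substituting variables and constants creates no redex.
sub-reflects-⟶β : ∀ {σ} → InertSub σ → ∀ M {N} → sub σ M ⟶β N →
  Σ[ M' ∈ Term ] (M ⟶β M' × N ≡ sub σ M')
sub-reflects-⟶β inert (var x) st = ⊥-elim (Inert-normal (inert x) _ st)
sub-reflects-⟶β inert (lam P) (ξlam st) with sub-reflects-⟶β (exts-inert inert) P st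
... | P' , P⟶P' , refl = lam P' , ξlam P⟶P' , refl
sub-reflects-⟶β inert (Λ P) (ξΛ st) with sub-reflects-⟶β (extsᵀ-inert inert) P st
... | P' , P⟶P' , refl = Λ P' , ξΛ P⟶P' , refl
sub-reflects-⟶β inert (var x · Q) st with Inert-app-⟶β (inert x) st
... | _ , st' , refl with sub-reflects-⟶β inert Q st'
...   | Q' , Q⟶Q' , refl = var x · Q' , ξappʳ Q⟶Q' , refl
sub-reflects-⟶β {σ} inert (lam P · Q) β = P [ Q ] , β , sub-[] σ P Q
sub-reflects-⟶β inert (M · Q) (ξappˡ st) with sub-reflects-⟶β inert M st
... | M' , M⟶M' , refl = M' · Q , ξappˡ M⟶M' , refl
sub-reflects-⟶β inert (M · Q) (ξappʳ st) with sub-reflects-⟶β inert Q st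
... | Q' , Q⟶Q' , refl = M · Q' , ξappʳ Q⟶Q' , refl
sub-reflects-⟶β inert (var x ·ᵀ Y) st = ⊥-elim (Inert-tapp-normal (inert x) _ st)
sub-reflects-⟶β {σ} inert (Λ P ·ᵀ Y) βᵀ = P [ Y ]ᵀ , βᵀ , sub-[]ᵀ σ P Y
sub-reflects-⟶β inert (M ·ᵀ Y) (ξtapp st) with sub-reflects-⟶β inert M st
... | M' , M⟶M' , refl = M' ·ᵀ Y , ξtapp M⟶M' , refl

renTT-reflects-⟶β : ∀ ρ M {N} → renTT ρ M ⟶β N → Σ[ M' ∈ Term ] (M ⟶β M' × N ≡ renTT ρ M')
renTT-reflects-⟶β ρ (lam P) (ξlam st) with renTT-reflects-⟶β ρ P st
... | P' , P⟶P' , refl = lam P' , ξlam P⟶P' , refl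
renTT-reflects-⟶β ρ (Λ P) (ξΛ st) with renTT-reflects-⟶β (extR ρ) P st
... | P' , P⟶P' , refl = Λ P' , ξΛ P⟶P' , refl
renTT-reflects-⟶β ρ (lam P · Q) β = P [ Q ] , β , renTT-[] ρ P Q
renTT-reflects-⟶β ρ (M · Q) (ξappˡ st) with renTT-reflects-⟶β ρ M st
... | M' , M⟶M' , refl = M' · Q , ξappˡ M⟶M' , refl
renTT-reflects-⟶β ρ (M · Q) (ξappʳ st) with renTT-reflects-⟶β ρ Q st
... | Q' , Q⟶Q' , refl = M · Q' , ξappʳ Q⟶Q' , refl
renTT-reflects-⟶β ρ (Λ P ·ᵀ Y) βᵀ = P [ Y ]ᵀ , βᵀ , renTT-[]ᵀ ρ P Y
renTT-reflects-⟶β ρ (M ·ᵀ Y) (ξtapp st) with renTT-reflects-⟶β ρ M st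
... | M' , M⟶M' , refl = M' ·ᵀ Y , ξtapp M⟶M' , refl

sub-reflects-↠ : ∀ {σ} → InertSub σ → ∀ M {N} → sub σ M ↠ N → Σ[ M' ∈ Term ] (M ↠ M' × N ≡ sub σ M')
sub-reflects-↠ inert M ε = M , ε , refl
sub-reflects-↠ inert M (st ◅ r) with sub-reflects-⟶β inert M st
... | M₁ , M⟶M₁ , refl with sub-reflects-↠ inert M₁ r
...   | M' , M₁↠M' , N≡ = M' , M⟶M₁ ◅ M₁↠M' , N≡

renTT-reflects-↠ : ∀ ρ M {N} → renTT ρ M ↠ N → Σ[ M' ∈ Term ] (M ↠ M' × N ≡ renTT ρ M')
renTT-reflects-↠ ρ M ε = M , ε , refl
renTT-reflects-↠ ρ M (st ◅ r) with renTT-reflects-⟶β ρ M st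
... | M₁ , M⟶M₁ , refl with renTT-reflects-↠ ρ M₁ r
...   | M' , M₁↠M' , N≡ = M' , M⟶M₁ ◅ M₁↠M' , N≡

∋-map : ∀ {f Γ x A} → Γ ∋ x ∶ A → map f Γ ∋ x ∶ f A
∋-map here      = here
∋-map (there p) = there (∋-map p)

∋-map⁻ : ∀ {f Γ x B} → map f Γ ∋ x ∶ B → Σ[ A ∈ Formula ] (Γ ∋ x ∶ A × B ≡ f A)
∋-map⁻ {Γ = A ∷ Γ} here = A , here , refl
∋-map⁻ {Γ = A ∷ Γ} (there p) with ∋-map⁻ {Γ = Γ} p
... | A₀ , q , B≡ = A₀ , there q , B≡

map-shiftF-renF : ∀ ρ Γ → map (renF (extR ρ)) (map shiftF Γ) ≡ map shiftF (map (renF ρ) Γ)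
map-shiftF-renF ρ Γ = begin
  map (renF (extR ρ)) (map shiftF Γ)  ≡⟨ map-∘ Γ ⟨
  map (renF (extR ρ) ∘ shiftF) Γ      ≡⟨ map-cong (shiftF-renF ρ) Γ ⟩
  map (shiftF ∘ renF ρ) Γ             ≡⟨ map-∘ Γ ⟩
  map shiftF (map (renF ρ) Γ)         ∎
  where open ≡-Reasoning

⊢-renTT : ∀ ρ {Γ t A} → Γ ⊢ t ∶ A → map (renF ρ) Γ ⊢ renTT ρ t ∶ renF ρ A
⊢-renTT ρ (⊢var p)   = ⊢var (∋-map p)
⊢-renTT ρ ⊢con       = ⊢con
⊢-renTT ρ (⊢lam d)   = ⊢lam (⊢-renTT ρ d)
⊢-renTT ρ (⊢app d e) = ⊢app (⊢-renTT ρ d) (⊢-renTT ρ e)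
⊢-renTT ρ {Γ} (⊢Λ d) = ⊢Λ (subst (_⊢ _ ∶ _) (map-shiftF-renF ρ Γ) (⊢-renTT (extR ρ) d))
⊢-renTT ρ (⊢tapp {A = A} Y d) =
  subst (_ ⊢ _ ∶_) (instF-renF ρ A Y) (⊢tapp (ρ Y) (⊢-renTT ρ d))

⊢-tapp⁻ : ∀ {Γ t Y B} → Γ ⊢ t ·ᵀ Y ∶ B → Σ[ A ∈ Formula ] (Γ ⊢ t ∶ all A × B ≡ instF A Y)
⊢-tapp⁻ (⊢tapp _ d) = _ , d , refl

⊢-app-con⁻ : ∀ {Γ t B C} → Γ ⊢ t · con B ∶ C → Γ ⊢ t ∶ B ⇒ C
⊢-app-con⁻ (⊢app d ⊢con) = d

⊢-ren-suc-inert⁻ : ∀ {Δ A B w} → Inert w → (A ∷ Δ) ⊢ ren suc w ∶ B → Δ ⊢ w ∶ B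
⊢-ren-suc-inert⁻ var (⊢var (there p)) = ⊢var p
⊢-ren-suc-inert⁻ con ⊢con             = ⊢con

⊢-shift-inert⁻ : ∀ {Δ B w} → Inert w → map shiftF Δ ⊢ renTT suc w ∶ B →
  Σ[ A ∈ Formula ] (Δ ⊢ w ∶ A × B ≡ shiftF A)
⊢-shift-inert⁻ {Δ} var (⊢var p) with ∋-map⁻ {Γ = Δ} p
... | A , q , B≡ = A , ⊢var q , B≡
⊢-shift-inert⁻ con ⊢con = _ , ⊢con , refl

ReflectsTypes : Ctx → Ctx → (ℕ → Term) → Set
ReflectsTypes Γ Δ σ = ∀ x A → Δ ⊢ σ x ∶ A → Γ ∋ x ∶ A

exts-reflects : ∀ {Γ Δ σ A} → InertSub σ → ReflectsTypes Γ Δ σ →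
  ReflectsTypes (A ∷ Γ) (A ∷ Δ) (exts σ)
exts-reflects inert σ⁻ zero    _ (⊢var here) = here
exts-reflects inert σ⁻ (suc x) B d           = there (σ⁻ x B (⊢-ren-suc-inert⁻ (inert x) d))

extsᵀ-reflects : ∀ {Γ Δ σ} → InertSub σ → ReflectsTypes Γ Δ σ →
  ReflectsTypes (map shiftF Γ) (map shiftF Δ) (extsᵀ σ)
extsᵀ-reflects inert σ⁻ x B d with ⊢-shift-inert⁻ (inert x) d
... | A , d' , refl = ∋-map (σ⁻ x A d')

sub0-con-reflects : ∀ {Γ B} → ReflectsTypes (B ∷ Γ) Γ (sub0 (con B))
sub0-con-reflects zero    _ ⊢con     = here
sub0-con-reflects (suc x) _ (⊢var p) = there p

sub-reflects-⊢ : ∀ {Γ Δ σ} → InertSub σ → ReflectsTypes Γ Δ σ → ∀ M {C} → Δ ⊢ sub σ M ∶ C → Γ ⊢ M ∶ C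
sub-reflects-⊢ inert σ⁻ (var x)  d            = ⊢var (σ⁻ x _ d)
sub-reflects-⊢ inert σ⁻ (con A)  ⊢con         = ⊢con
sub-reflects-⊢ inert σ⁻ (lam P)  (⊢lam d)     =
  ⊢lam (sub-reflects-⊢ (exts-inert inert) (exts-reflects inert σ⁻) P d)
sub-reflects-⊢ inert σ⁻ (P · Q)  (⊢app d e)   =
  ⊢app (sub-reflects-⊢ inert σ⁻ P d) (sub-reflects-⊢ inert σ⁻ Q e)
sub-reflects-⊢ inert σ⁻ (Λ P)    (⊢Λ d)       =
  ⊢Λ (sub-reflects-⊢ (extsᵀ-inert inert) (extsᵀ-reflects inert σ⁻) P d)
sub-reflects-⊢ inert σ⁻ (P ·ᵀ Y) (⊢tapp .Y d) = ⊢tapp Y (sub-reflects-⊢ inert σ⁻ P d)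

data Abstraction : Term → Set where
  lam : ∀ {t} → Abstraction (lam t)
  Λ   : ∀ {t} → Abstraction (Λ t)

app-head-not-abstraction : ∀ {Γ t s A B} → Γ ⊢ t ∶ A ⇒ B → Normal (t · s) → ¬ Abstraction t
app-head-not-abstraction _  nf lam = nf _ β
app-head-not-abstraction () _  Λ

tapp-head-not-abstraction : ∀ {Γ t Y A} → Γ ⊢ t ∶ all A → Normal (t ·ᵀ Y) → ¬ Abstraction t
tapp-head-not-abstraction () _  lam
tapp-head-not-abstraction _  nf Λ = nf _ βᵀ

type-below : ∀ {k t A} → [] ⊢ t ∶ A → Normal t → ¬ Abstraction t → BelowT k t → BelowF k A
type-below (⊢var ())
type-below ⊢con       _  _    A<k = A<k
type-below (⊢lam _)   _  ¬abs _   = ⊥-elim (¬abs lam)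
type-below (⊢Λ _)     _  ¬abs _   = ⊥-elim (¬abs Λ)
type-below (⊢app d _) nf _    (t<k , _) =
  proj₂ (type-below d (Normal-app-head nf) (app-head-not-abstraction d nf) t<k)
type-below (⊢tapp {A = A} Y d) nf _ (t<k , Y<k) =
  BelowF-renF (inst-below Y<k) A (type-below d (Normal-tapp-head nf) (tapp-head-not-abstraction d nf) t<k)

uninst : ℕ → ℕ → ℕ
uninst k x with x ≟ k
... | yes _ = zero
... | no  _ = suc x

uninst-inst : ∀ k {x} → x < suc k → uninst k (inst k x) ≡ x
uninst-inst k {zero} _ with k ≟ k
... | yes _   = refl
... | no  k≢k = ⊥-elim (k≢k refl)
uninst-inst k {suc x} (s≤s x<k) with x ≟ k
... | yes refl = ⊥-elim (<-irrefl refl x<k)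
... | no  _    = refl

renF-uninst-inst : ∀ k A → BelowF (suc k) A → renF (uninst k) (instF A k) ≡ A
renF-uninst-inst k A A<k =
  trans (renF-∘ {h = uninst k ∘ inst k} (λ _ → refl) A) (renF-id-below (uninst-inst k) A A<k)

renTT-uninst-inst : ∀ k t → BelowT (suc k) t → renTT (uninst k) (t [ k ]ᵀ) ≡ t
renTT-uninst-inst k t t<k =
  trans (renTT-∘ {h = uninst k ∘ inst k} (λ _ → refl) t) (renTT-id-below (uninst-inst k) t t<k)

instF-injective-fresh : ∀ k {A A'} → BelowF (suc k) A → BelowF (suc k) A' → instF A k ≡ instF A' k → A ≡ A'
instF-injective-fresh k {A} {A'} A<k A'<k eq = begin
  A                             ≡⟨ renF-uninst-inst k A A<k ⟨
  renF (uninst k) (instF A k)   ≡⟨ cong (renF (uninst k)) eq ⟩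
  renF (uninst k) (instF A' k)  ≡⟨ renF-uninst-inst k A' A'<k ⟩
  A'                            ∎
  where open ≡-Reasoning

⊢-tapp-fresh⁻ : ∀ {u A k} → BelowT k u → BelowF (suc k) A → Normal (u ·ᵀ k) →
  [] ⊢ u ·ᵀ k ∶ instF A k → [] ⊢ u ∶ all A
⊢-tapp-fresh⁻ {u} {A} {k} u<k A<k nf d with ⊢-tapp⁻ d
... | A' , d' , A≡ = subst (λ B → [] ⊢ u ∶ all B) (sym (instF-injective-fresh k A<k A'<k A≡)) d'
  where
    A'<k : BelowF (suc k) A'
    A'<k = type-below d' (Normal-tapp-head nf) (tapp-head-not-abstraction d' nf) u<k

HasNf : Formula → Term → Set
HasNf A t = Σ[ s ∈ Term ] (t ↠ s × Normal s × [] ⊢ s ∶ A)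

HasNf-↞ : ∀ {A t u} → t ↠ u → HasNf A u → HasNf A t
HasNf-↞ t↠u (s , u↠s , nf , d) = s , t↠u ◅◅ u↠s , nf , d

↠-app-inv : ∀ {u c v} → Normal c → u · c ↠ v →
  (Σ[ u' ∈ Term ] (u ↠ u' × v ≡ u' · c)) ⊎ (Σ[ M ∈ Term ] (u ↠ lam M × M [ c ] ↠ v))
↠-app-inv nc ε = inj₁ (_ , ε , refl)
↠-app-inv nc (β ◅ r) = inj₂ (_ , ε , r)
↠-app-inv nc (ξappʳ st ◅ r) = ⊥-elim (nc _ st)
↠-app-inv nc (ξappˡ st ◅ r) with ↠-app-inv nc r
... | inj₁ (u' , u↠u' , v≡) = inj₁ (u' , st ◅ u↠u' , v≡)
... | inj₂ (M , u↠λM , M[c]↠v) = inj₂ (M , st ◅ u↠λM , M[c]↠v)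

↠-tapp-inv : ∀ {u Y v} → u ·ᵀ Y ↠ v →
  (Σ[ u' ∈ Term ] (u ↠ u' × v ≡ u' ·ᵀ Y)) ⊎ (Σ[ M ∈ Term ] (u ↠ Λ M × M [ Y ]ᵀ ↠ v))
↠-tapp-inv ε = inj₁ (_ , ε , refl)
↠-tapp-inv (βᵀ ◅ r) = inj₂ (_ , ε , r)
↠-tapp-inv (ξtapp st ◅ r) with ↠-tapp-inv r
... | inj₁ (u' , u↠u' , v≡) = inj₁ (u' , st ◅ u↠u' , v≡)
... | inj₂ (M , u↠ΛM , M[Y]↠v) = inj₂ (M , st ◅ u↠ΛM , M[Y]↠v)

HasNf-app-con⁻ : ∀ {u B C} → HasNf C (u · con B) → HasNf (B ⇒ C) u
HasNf-app-con⁻ {B = B} (v , r , nf , d) with ↠-app-inv Normal-con r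
... | inj₁ (u' , u↠u' , refl) = u' , u↠u' , Normal-app-head nf , ⊢-app-con⁻ d
... | inj₂ (M , u↠λM , M[c]↠v) with sub-reflects-↠ (sub0-inert con) M M[c]↠v
...   | M' , M↠M' , refl =
  lam M' , u↠λM ◅◅ gmap lam ξlam M↠M' ,
  Normal-lam (Normal-sub⁻ (sub0 (con B)) nf) ,
  ⊢lam (sub-reflects-⊢ (sub0-inert con) sub0-con-reflects M' d)

HasNf-tapp-fresh⁻ : ∀ {u A k} → BelowT k u → BelowF (suc k) A →
  HasNf (instF A k) (u ·ᵀ k) → HasNf (all A) u
HasNf-tapp-fresh⁻ {u} {k = k} u<k A<k (v , r , nf , d) with ↠-tapp-inv r
... | inj₁ (u' , u↠u' , refl) =
  u' , u↠u' , Normal-tapp-head nf , ⊢-tapp-fresh⁻ (BelowT-↠ u↠u' u<k) A<k nf d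
... | inj₂ (M , u↠ΛM , M[k]↠v) with renTT-reflects-↠ (inst k) M M[k]↠v
...   | M' , M↠M' , refl =
  Λ M' , u↠ΛM' , Normal-Λ (Normal-renTT⁻ (inst k) nf) ,
  ⊢Λ (subst₂ ([] ⊢_∶_) (renTT-uninst-inst k M' (BelowT-↠ u↠ΛM' u<k))
                       (renF-uninst-inst k _ A<k)
                       (⊢-renTT (uninst k) d))
  where
    u↠ΛM' : u ↠ Λ M'
    u↠ΛM' = u↠ΛM ◅◅ gmap Λ ξΛ M↠M'

ConHead : Term → Set
ConHead (con _)  = ⊤
ConHead (t · _)  = ConHead t
ConHead (t ·ᵀ _) = ConHead t
ConHead (var _)  = ⊥
ConHead (lam _)  = ⊥
ConHead (Λ _)    = ⊥

ConHead-spine : ∀ {h} → ConHead h → ∀ Ts → ConHead (spine h Ts)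
ConHead-spine     ch []            = ch
ConHead-spine {h} ch (inj₁ s ∷ Ts) = ConHead-spine {h · s} ch Ts
ConHead-spine {h} ch (inj₂ Y ∷ Ts) = ConHead-spine {h ·ᵀ Y} ch Ts

ConHead-⟶β : ∀ {t t'} → ConHead t → t ⟶β t' → ConHead t'
ConHead-⟶β ch (ξappˡ st) = ConHead-⟶β ch st
ConHead-⟶β ch (ξappʳ st) = ch
ConHead-⟶β ch (ξtapp st) = ConHead-⟶β ch st

ConHead-↠ : ∀ {t t'} → ConHead t → t ↠ t' → ConHead t'
ConHead-↠ ch ε        = ch
ConHead-↠ ch (st ◅ r) = ConHead-↠ (ConHead-⟶β ch st) r

Normal-app : ∀ {t s} → ConHead t → Normal t → Normal s → Normal (t · s)
Normal-app ch nt ns _ β          = ch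
Normal-app ch nt ns _ (ξappˡ st) = nt _ st
Normal-app ch nt ns _ (ξappʳ st) = ns _ st

Normal-tapp : ∀ {t Y} → ConHead t → Normal t → Normal (t ·ᵀ Y)
Normal-tapp ch nt _ βᵀ         = ch
Normal-tapp ch nt _ (ξtapp st) = nt _ st

⟦⟧-con : ∀ {A} → ⟦ A ⟧ (con A)
⟦⟧-con = tt , _ , ε , Normal-con , ⊢con

⟦⟧-app : ∀ {t s B C} → ConHead t → ⟦ B ⇒ C ⟧ t → ⟦ B ⟧ s → ⟦ C ⟧ (t · s)
⟦⟧-app {s = s} ch (cl , w , t↠w , nw , dw) (cls , s' , s↠s' , ns' , ds') =
  (cl , cls) , w · s' ,
  gmap (_· s) ξappˡ t↠w ◅◅ gmap (w ·_) ξappʳ s↠s' ,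
  Normal-app (ConHead-↠ ch t↠w) nw ns' , ⊢app dw ds'

⟦⟧-tapp : ∀ {t A Y} → ConHead t → ⟦ all A ⟧ t → ⟦ instF A Y ⟧ (t ·ᵀ Y)
⟦⟧-tapp {Y = Y} ch (cl , w , t↠w , nw , dw) =
  cl , w ·ᵀ Y , gmap (_·ᵀ Y) ξtapp t↠w , Normal-tapp (ConHead-↠ ch t↠w) nw , ⊢tapp Y dw

record Adequate (n : ℕ) (A : Formula) : Set where
  field
    conHead-in : ∀ {t} → ConHead t → ⟦ A ⟧ t → dagN n A t
    sound      : ∀ {t} → dagN n A t → ⟦ A ⟧ t

open Adequate

adequate-atom : ∀ {n X} → Adequate (suc n) (atom X)
adequate-atom = record { conHead-in = λ _ ⟦t⟧ → ⟦t⟧ ; sound = λ t† → t† }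

adequate-⇒ : ∀ {n B C} → Adequate n B → Adequate n C → Adequate (suc n) (B ⇒ C)
adequate-⇒ {n} {B} adB adC = record
  { conHead-in = λ { ch ⟦t⟧@(cl , _) →
      cl , _ , ε , η⇒ , λ s s† → conHead-in adC ch (⟦⟧-app ch ⟦t⟧ (sound adB s†)) }
  ; sound = λ { (cl , u , t↠u , _ , app†) →
      cl , HasNf-↞ t↠u (HasNf-app-con⁻ (proj₂ (sound adC (app† (con B) c†)))) }
  }
  where
    c† : dagN n B (con B)
    c† = conHead-in adB tt ⟦⟧-con

adequate-∀ : ∀ {n A} → (∀ Y → Adequate n (instF A Y)) → Adequate (suc n) (all A)
adequate-∀ {n} {A} adA = record
  { conHead-in = λ { ch ⟦t⟧@(cl , _) →
      cl , _ , ε , η∀ , λ Y → conHead-in (adA Y) ch (⟦⟧-tapp ch ⟦t⟧) }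
  ; sound = λ { (cl , u , t↠u , _ , tapp†) → cl , HasNf-↞ t↠u (fresh-instance u tapp†) }
  }
  where
    fresh-instance : ∀ u → (∀ Y → dagN n (instF A Y) (u ·ᵀ Y)) → HasNf (all A) u
    fresh-instance u tapp† with fresh-atom u A
    ... | k , u<k , A<k = HasNf-tapp-fresh⁻ u<k A<k (proj₂ (sound (adA k) (tapp† k)))

adequate : ∀ {n} A → size A ≤ n → Adequate n A
adequate (atom X) (s≤s _)  = adequate-atom
adequate (B ⇒ C)  (s≤s le) =
  adequate-⇒ (adequate B (≤-trans (m≤m+n _ _) le)) (adequate C (≤-trans (m≤n+m _ _) le))
adequate (all A)  (s≤s le) =
  adequate-∀ λ Y → adequate (instF A Y) (subst (_≤ _) (sym (size-renF (inst Y) A)) le)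

mainTheorem7 : (A : Formula) →
    ((D : Formula) (Ts : List (Term ⊎ ℕ)) →
      ⟦ A ⟧ (spine (con D) Ts) → (A †) (spine (con D) Ts))
    × ((t : Term) → (A †) t → ⟦ A ⟧ t)
mainTheorem7 A =
  (λ D Ts → conHead-in adA (ConHead-spine tt Ts)) , (λ t → sound adA)
  where
    adA : Adequate (size A) A
    adA = adequate A ≤-refl
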